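{- Let $A$ be a base-$a$ algorithm given by $\Lambda:\{0,1,\dots,a-1\}\to\mathbb{N}$, and let $G(A)$ be its graph. For every walk $(v_0,v_1,\dots,v_k)$ on $G(A)$ ending at the vertex $1$ (that is, $v_k=1$), there exists a natural number $n$ such that $R(n)=(v_0,v_1,\dots,v_k)$.
   Context: "$x\bmod y$" denotes the remainder on dividing $x$ by $y$. A base-$a$ algorithm $A$ ($a\ge2$) is given by a map $\Lambda:X\to\mathbb{N}$, $X=\{0,1,\dots,a-1\}$, with $\Lambda(i)\ge 2$ and $\Lambda(i)\mid a$ for all $i$. Applied to $n\in\mathbb{N}$: set $n_0=n$ and iteratively $r_i=n_i\bmod a$, $\lambda_i=\Lambda(r_i)$, $s_i=n_i\bmod\lambda_i$, $n_{i+1}=(n_i-s_i)/\lambda_i$, stopping at the first $k$ with $n_k=1$ (and $r_k = 1$); this gives $n=\lambda_0(\lambda_1(\cdots(\lambda_{k-1}+s_{k-1})\cdots)+s_1)+s_0$. The residue sequence is $R(n)=(r_0,r_1,\dots,r_k)$. A residue $j$ is a successor of a residue $i$ if some natural number $m\equiv i\pmod a$ satisfies $(m-(m\bmod\Lambda(i)))/\Lambda(i)\equiv j\pmod a$. The graph $G(A)$ is the directed graph on vertex set $X$ with an edge $(i,j)$ exactly when $j$ is a successor of $i$; a walk is a finite sequence of vertices in which each consecutive pair is an edge. -}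

module Defs where

open import Data.Nat using (ℕ; zero; suc; _∸_; _≤_; _<_; NonZero; >-nonZero; s≤s; z≤n)
open import Data.Nat.Properties using (≤-trans)
open import Data.Nat.DivMod using (_mod_; _%_; _/_)
open import Data.Fin using (Fin)
open import Data.List using (List; []; _∷_)
open import Data.Product using (Σ; _×_)
open import Relation.Binary.PropositionalEquality using (_≡_; _≢_)

-- A base-a algorithm: a ≥ 2 (NonZero a supplied as instance), Λ : X → ℕ with
-- Λ i ≥ 2 (and Λ i ∣ a, which is assumed in the theorem statement; the
-- definitions below only need Λ i ≥ 2 to make division meaningful).
module Algorithm (a : ℕ) .{{nz : NonZero a}} (Λ : Fin a → ℕ)
                 (Λ≥2 : (i : Fin a) → 2 ≤ Λ i) where

  instance
    Λ-nonZero : {i : Fin a} → NonZero (Λ i)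
    Λ-nonZero {i} = >-nonZero (≤-trans (s≤s z≤n) (Λ≥2 i))

  -- one step of the algorithm: n_{i+1} = (n_i - s_i)/λ_i,
  -- where r_i = n_i mod a, λ_i = Λ(r_i), s_i = n_i mod λ_i
  next : ℕ → ℕ
  next n = (n ∸ (n % Λ (n mod a))) / Λ (n mod a)

  -- ResidueSeq n rs  ⇔  R(n) = rs : the algorithm run on n stops
  -- (at the first k with n_k = 1) with residue sequence rs = (r_0,…,r_k).
  data ResidueSeq : ℕ → List (Fin a) → Set where
    stop : ResidueSeq 1 ((1 mod a) ∷ [])
    step : {n : ℕ} {rs : List (Fin a)} → n ≢ 1 →
           ResidueSeq (next n) rs → ResidueSeq n ((n mod a) ∷ rs)

  Edge : Fin a → Fin a → Set
  Edge i j = Σ ℕ λ m → (m mod a ≡ i) × (((m ∸ (m % Λ i)) / Λ i) mod a ≡ j)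

  data Walk : List (Fin a) → Set where
    single : (v : Fin a) → Walk (v ∷ [])
    cons   : {v w : Fin a} {vs : List (Fin a)} →
             Edge v w → Walk (w ∷ vs) → Walk (v ∷ w ∷ vs)

module Submission where

-- The proof builds n backwards along the walk.  The last vertex 1 is realised
-- by n = 1.  Given a number n' ≥ 1 realising the walk (w, …, 1) and an edge
-- v → w witnessed by some m ≡ v (mod a) with ⌊m / Λ v⌋ ≡ w (mod a), the number
--   n = (m mod Λ v) + n' · Λ v
-- satisfies n ≡ m ≡ v (mod a) (since n' ≡ ⌊m / Λ v⌋ (mod a)), one step of the
-- algorithm sends it to n', and n ≥ Λ v ≥ 2, so the run does not stop at n.

open import Defs
open import Data.Nat using (ℕ; _≤_; _<_; NonZero; _+_; _*_; _∸_; _%_; _/_; s≤s; z≤n)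
open import Data.Nat.Properties
  using (≤-trans; ≤-reflexive; *-identityˡ; *-monoˡ-≤; m≤n+m; m+n∸m≡n; 1+n≰n)
open import Data.Nat.DivMod
open import Data.Nat.Divisibility using (_∣_; n∣m*n)
open import Data.Fin using (Fin; fromℕ<; toℕ)
open import Data.Fin.Properties using (toℕ-injective; toℕ-fromℕ<)
open import Data.List using (List; last; []; _∷_)
open import Data.Maybe using (just)
open import Data.Maybe.Properties using (just-injective)
open import Data.Product using (Σ; _,_; _×_)
open import Data.Empty using (⊥)
open import Relation.Binary.PropositionalEquality
  using (_≡_; refl; sym; trans; cong; subst; module ≡-Reasoning)

toℕ-mod : ∀ m d .{{_ : NonZero d}} → toℕ (m mod d) ≡ m % d
toℕ-mod m d = toℕ-fromℕ< (m%n<n m d)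

%-≡⇒mod-≡ : ∀ x y d .{{_ : NonZero d}} → x % d ≡ y % d → x mod d ≡ y mod d
%-≡⇒mod-≡ x y d e = toℕ-injective (trans (toℕ-mod x d) (trans e (sym (toℕ-mod y d))))

mod-≡⇒%-≡ : ∀ x y d .{{_ : NonZero d}} → x mod d ≡ y mod d → x % d ≡ y % d
mod-≡⇒%-≡ x y d e = trans (sym (toℕ-mod x d)) (trans (cong toℕ e) (toℕ-mod y d))

mod-small : ∀ {m d} .{{_ : NonZero d}} (m<d : m < d) → m mod d ≡ fromℕ< m<d
mod-small {m} {d} m<d =
  toℕ-injective (trans (toℕ-mod m d) (trans (m<n⇒m%n≡m m<d) (sym (toℕ-fromℕ< m<d))))

%-affine-cong : ∀ t l {x y} d .{{_ : NonZero d}} →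
                x % d ≡ y % d → (t + x * l) % d ≡ (t + y * l) % d
%-affine-cong t l {x} {y} d e = begin
  (t + x * l) % d                           ≡⟨ %-distribˡ-+ t (x * l) d ⟩
  (t % d + (x * l) % d) % d                 ≡⟨ cong (λ z → (t % d + z) % d) (%-distribˡ-* x l d) ⟩
  (t % d + ((x % d) * (l % d)) % d) % d     ≡⟨ cong (λ z → (t % d + (z * (l % d)) % d) % d) e ⟩
  (t % d + ((y % d) * (l % d)) % d) % d     ≡⟨ cong (λ z → (t % d + z) % d) (sym (%-distribˡ-* y l d)) ⟩
  (t % d + (y * l) % d) % d                 ≡⟨ sym (%-distribˡ-+ t (y * l) d) ⟩
  (t + y * l) % d                           ∎
  where open ≡-Reasoning

[m∸m%l]/l≡m/l : ∀ m l .{{_ : NonZero l}} → (m ∸ m % l) / l ≡ m / l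
[m∸m%l]/l≡m/l m l = begin
  (m ∸ m % l) / l                       ≡⟨ /-congˡ (cong (_∸ m % l) (m≡m%n+[m/n]*n m l)) ⟩
  (m % l + (m / l) * l ∸ m % l) / l     ≡⟨ /-congˡ (m+n∸m≡n (m % l) ((m / l) * l)) ⟩
  (m / l) * l / l                       ≡⟨ m*n/n≡m (m / l) l ⟩
  m / l                                 ∎
  where open ≡-Reasoning

[t+x*l]/l≡x : ∀ {t} x l .{{_ : NonZero l}} → t < l → (t + x * l) / l ≡ x
[t+x*l]/l≡x {t} x l t<l = begin
  (t + x * l) / l       ≡⟨ +-distrib-/-∣ʳ t (n∣m*n x) ⟩
  t / l + x * l / l     ≡⟨ cong (_+ x * l / l) (m<n⇒m/n≡0 t<l) ⟩
  x * l / l             ≡⟨ m*n/n≡m x l ⟩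
  x                     ∎
  where open ≡-Reasoning

module Realisation (a : ℕ) .{{nz : NonZero a}} (Λ : Fin a → ℕ)
                   (Λ≥2 : (i : Fin a) → 2 ≤ Λ i) where
  open Algorithm a Λ Λ≥2

  next≡/ : ∀ n → next n ≡ n / Λ (n mod a)
  next≡/ n = [m∸m%l]/l≡m/l n (Λ (n mod a))

  head-residue : ∀ {n w vs} → ResidueSeq n (w ∷ vs) → n mod a ≡ w
  head-residue stop       = refl
  head-residue (step _ _) = refl

  extend : ∀ {v w} → Edge v w → ∀ n' → 1 ≤ n' → n' mod a ≡ w →
           Σ ℕ λ n → (2 ≤ n) × (n mod a ≡ v) × (next n ≡ n')
  extend {v} (m , m≡v , step-m≡w) n' 1≤n' n'≡w = n , 2≤n , n≡v , next-n≡n'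
    where
    l = Λ v
    t = m % l
    n = t + n' * l

    t<l : t < l
    t<l = m%n<n m l

    -- ⌊m / l⌋ and n' are congruent modulo a: both have residue w.
    m/l≡n' : (m / l) % a ≡ n' % a
    m/l≡n' = mod-≡⇒%-≡ (m / l) n' a
               (trans (sym (cong (_mod a) ([m∸m%l]/l≡m/l m l))) (trans step-m≡w (sym n'≡w)))

    2≤n : 2 ≤ n
    2≤n = ≤-trans (Λ≥2 v)
            (≤-trans (≤-trans (≤-reflexive (sym (*-identityˡ l))) (*-monoˡ-≤ l 1≤n'))
                     (m≤n+m (n' * l) t))

    n≡v : n mod a ≡ v
    n≡v = trans (%-≡⇒mod-≡ n m a n%a≡m%a) m≡v
      where
      n%a≡m%a : n % a ≡ m % a
      n%a≡m%a = trans (%-affine-cong t l a (sym m/l≡n')) (cong (_% a) (sym (m≡m%n+[m/n]*n m l)))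

    next-n≡n' : next n ≡ n'
    next-n≡n' = begin
      next n                ≡⟨ next≡/ n ⟩
      n / Λ (n mod a)       ≡⟨ cong (λ u → n / Λ u) n≡v ⟩
      n / l                 ≡⟨ [t+x*l]/l≡x n' l t<l ⟩
      n'                    ∎
      where open ≡-Reasoning

  walk-realised : ∀ (a≥2 : 2 ≤ a) vs → Walk vs → last vs ≡ just (fromℕ< a≥2) →
                  Σ ℕ λ n → (1 ≤ n) × ResidueSeq n vs
  walk-realised a≥2 (v ∷ []) (single v) ends-at-1 =
    1 , s≤s z≤n , subst (λ u → ResidueSeq 1 (u ∷ [])) 1-mod≡v stop
    where
    1-mod≡v : 1 mod a ≡ v
    1-mod≡v = trans (mod-small a≥2) (sym (just-injective ends-at-1))
  walk-realised a≥2 (v ∷ w ∷ vs) (cons edge walk) ends-at-1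
    with walk-realised a≥2 (w ∷ vs) walk ends-at-1
  ... | n' , 1≤n' , R-n'
    with extend edge n' 1≤n' (head-residue R-n')
  ... | n , 2≤n , n≡v , next-n≡n' =
    n , ≤-trans (s≤s z≤n) 2≤n ,
    subst (λ u → ResidueSeq n (u ∷ w ∷ vs)) n≡v
      (step n≢1 (subst (λ k → ResidueSeq k (w ∷ vs)) (sym next-n≡n') R-n'))
    where
    n≢1 : n ≡ 1 → ⊥
    n≢1 n≡1 = 1+n≰n (subst (2 ≤_) n≡1 2≤n)

mainTheorem3 : (a : ℕ) .{{nz : NonZero a}} (a≥2 : 2 ≤ a) (Λ : Fin a → ℕ)
    (Λ≥2 : (i : Fin a) → 2 ≤ Λ i) (Λ∣a : (i : Fin a) → Λ i ∣ a) →
    (vs : List (Fin a)) → Algorithm.Walk a Λ Λ≥2 vs →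
    last vs ≡ just (fromℕ< a≥2) →
    Σ ℕ (λ n → Algorithm.ResidueSeq a Λ Λ≥2 n vs)
mainTheorem3 a a≥2 Λ Λ≥2 _ vs walk ends-at-1
  with Realisation.walk-realised a Λ Λ≥2 a≥2 vs walk ends-at-1
... | n , _ , R-n = n , R-n
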